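{- Let $p$ be a prime such that $p \bmod 9240$ is not one of the $34$ residues $$1, 169, 289, 361, 529, 841, 961, 1369, 1681, 1849, 2041, 2209, 2521, 2641, 2689, 2809, 3361,$$ $$3481, 3529, 3721, 4321, 4489, 5041, 5161, 5329, 5569, 6169, 6241, 6889, 7561, 7681, 7921, 8089, 8761.$$ Then there exist positive integers $x \le y \le z$ with $$\frac{4}{p} = \frac{1}{x} + \frac{1}{y} + \frac{1}{z} \quad\text{and}\quad x = \left\lfloor \frac{py}{4y-p} \right\rfloor + 1,$$ i.e. $p$ has at least one solution of type I(b).
   Context: For a prime $p$, a solution of $\frac{4}{p} = \frac{1}{x}+\frac{1}{y}+\frac{1}{z}$ is a triple of positive integers $(x,y,z)$ satisfying the equation, normalized so that $x \le y \le z$. A solution is of type I(b) if $x = \lfloor py/(4y-p)\rfloor + 1$. -}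

module Defs where

open import Data.Nat using (ℕ; _+_; _*_; _∸_; _≤_; _<_; _>_; _%_; >-nonZero)
open import Data.Nat.DivMod using (_/_)
open import Data.Product using (Σ; _×_; ∃-syntax)
open import Data.List using (List; _∷_; [])
open import Data.List.Membership.Propositional using (_∈_)
open import Relation.Binary.PropositionalEquality using (_≡_)
open import Relation.Nullary using (¬_)

EgyptianSol : ℕ → ℕ → ℕ → ℕ → Set
EgyptianSol p x y z =
  (0 < x) × (0 < y) × (0 < z) × (x ≤ y) × (y ≤ z) ×
  (4 * x * y * z ≡ p * (y * z + x * z + x * y))

-- x = ⌊ p y / (4y - p) ⌋ + 1 ; requires 4y > p so the denominator is positive
-- (automatic for any solution, since 1/y < 4/p).
TypeIb : ℕ → ℕ → ℕ → Set
TypeIb p x y = Σ (4 * y > p) λ h →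
  x ≡ _/_ (p * y) (4 * y ∸ p) {{>-nonZero (m<n⇒0<n∸m h)}} + 1
  where
  open import Data.Nat.Properties using (m<n⇒0<n∸m)

HasTypeIbSolution : ℕ → Set
HasTypeIbSolution p = ∃[ x ] ∃[ y ] ∃[ z ] (EgyptianSol p x y z × TypeIb p x y)

excludedResidues : List ℕ
excludedResidues =
  1 ∷ 169 ∷ 289 ∷ 361 ∷ 529 ∷ 841 ∷ 961 ∷ 1369 ∷ 1681 ∷ 1849 ∷ 2041 ∷ 2209 ∷
  2521 ∷ 2641 ∷ 2689 ∷ 2809 ∷ 3361 ∷ 3481 ∷ 3529 ∷ 3721 ∷ 4321 ∷ 4489 ∷
  5041 ∷ 5161 ∷ 5329 ∷ 5569 ∷ 6169 ∷ 6241 ∷ 6889 ∷ 7561 ∷ 7681 ∷ 7921 ∷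
  8089 ∷ 8761 ∷ []

{-# OPTIONS --safe #-}

-- Write p = r + 9240 k with r = p % 9240. If 4x = p + m and d₁, d₂ divide p x with
-- d₁ + d₂ = m t, then y = (p x / d₁) t and z = (p x / d₂) t satisfy m/(p x) = 1/y + 1/z,
-- hence 4/p = 1/x + 1/y + 1/z; if moreover x (x − 1) ≤ z, then x = ⌊p y / (4y − p)⌋ + 1.
-- For every residue r that is not excluded, one of sixteen families (a choice of m and of
-- the shapes of d₁, d₂) provides x, d₁, d₂, t as polynomials in k for which all the
-- required identities and inequalities hold coefficientwise, hence for every k.
-- Residues divisible by a prime q ∣ 9240, other than q itself, contain no primes.

module Submission where

open import Defs
open import Data.Bool using (Bool; true; T; _∧_)
open import Data.Bool.Properties using (T-∧)
open import Data.List using (List; []; _∷_; [_]; map)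
open import Data.List.Membership.Propositional using (_∈_)
import Data.List.Relation.Unary.All as All
open All using (All; all?; lookupAny)
open import Data.List.Relation.Unary.Any using (Any; any?; satisfied)
open import Data.Nat
open import Data.List.Membership.DecPropositional _≟_ using (_∈?_)
open import Data.Nat.DivMod using (m≡m%n+[m/n]*n; m%n<n; m<n⇒m%n≡m; m<n*o⇒m/o<n; /-monoˡ-≤; m*n/n≡m)
open import Data.Nat.Divisibility using (_∣_; _∣?_; ∣n∣m%n⇒∣m)
open import Data.Nat.Primality using (Prime; prime⇒irreducible; prime⇒nonZero)
open import Data.Nat.Properties
open import Data.Nat.Tactic.RingSolver using (solve; solve-∀)
open import Data.Product using (_×_; _,_; proj₁; proj₂)
open import Data.Sum using (_⊎_; [_,_]′)
open import Function using (_∘_)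
open import Function.Bundles using (Equivalence)
open import Relation.Binary.PropositionalEquality
  using (_≡_; _≢_; refl; sym; trans; cong; cong₂; subst; subst₂; module ≡-Reasoning)
open import Relation.Nullary using (¬_; ¬?; yes; no; contradiction)
open import Relation.Nullary.Decidable using (isYes; _×-dec_; _⊎-dec_; T?; toWitness)
open import Relation.Unary using (Decidable)

*-pos : ∀ {a n} → 0 < a → 0 < n → 0 < a * n
*-pos {suc a} {suc n} _ _ = z<s

/+1-unique : ∀ {n x a} .{{_ : NonZero n}} → x * n ≤ a + n → a < x * n → a / n + 1 ≡ x
/+1-unique {n} {suc s} {a} lower upper = trans (cong (_+ 1) a/n≡s) (+-comm s 1)
  where
  s*n≤a : s * n ≤ a
  s*n≤a = +-cancelʳ-≤ n (s * n) a (subst (_≤ a + n) (+-comm n (s * n)) lower)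

  a/n≡s : a / n ≡ s
  a/n≡s = ≤-antisym (≤-pred (m<n*o⇒m/o<n upper))
    (subst (_≤ a / n) (m*n/n≡m s n) (/-monoˡ-≤ n s*n≤a))

egyptian⇒p[x+y]<4xy : ∀ {p x y z} → 0 < p → EgyptianSol p x y z → p * (x + y) < 4 * x * y
egyptian⇒p[x+y]<4xy {p} {x} {y} {z} 0<p (0<x , 0<y , 0<z , _ , _ , eq) =
  *-cancelˡ-< z _ _ (begin-strict
    z * (p * (x + y))             <⟨ m<m+n _ (*-pos (*-pos 0<p 0<x) 0<y) ⟩
    z * (p * (x + y)) + p * x * y ≡⟨ solve (p ∷ x ∷ y ∷ z ∷ []) ⟩
    p * (y * z + x * z + x * y)   ≡⟨ eq ⟨
    4 * x * y * z                 ≡⟨ solve (x ∷ y ∷ z ∷ []) ⟩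
    z * (4 * x * y)               ∎)
  where open ≤-Reasoning

quotient-bounds : ∀ {p x y z} e → 0 < p → EgyptianSol p x y z → e + p ≡ 4 * y →
  x * x ≤ z + x → x * e ≤ p * y + e × p * y < x * e
quotient-bounds {p} {x} {y} {z} e 0<p sol@(0<x , _ , 0<z , _ , _ , eq) e+p≡4y x*x≤z+x =
  lower , upper
  where
  x*e*z≡p*y*[z+x] : x * e * z ≡ p * y * (z + x)
  x*e*z≡p*y*[z+x] = +-cancelʳ-≡ (x * p * z) _ _ (begin
    x * e * z + x * p * z       ≡⟨ solve (x ∷ e ∷ p ∷ z ∷ []) ⟩
    x * (e + p) * z             ≡⟨ cong (λ w → x * w * z) e+p≡4y ⟩
    x * (4 * y) * z             ≡⟨ solve (x ∷ y ∷ z ∷ []) ⟩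
    4 * x * y * z               ≡⟨ eq ⟩
    p * (y * z + x * z + x * y) ≡⟨ solve (p ∷ x ∷ y ∷ z ∷ []) ⟩
    p * y * (z + x) + x * p * z ∎)
    where open ≡-Reasoning

  lower : x * e ≤ p * y + e
  lower = *-cancelˡ-≤ (x * z) {{>-nonZero (*-pos 0<x 0<z)}} (begin
    x * z * (x * e)                   ≡⟨ solve (x ∷ z ∷ e ∷ []) ⟩
    x * (x * e * z)                   ≡⟨ cong (x *_) x*e*z≡p*y*[z+x] ⟩
    x * (p * y * (z + x))             ≡⟨ solve (x ∷ p ∷ y ∷ z ∷ []) ⟩
    p * y * (x * z + x * x)           ≤⟨ *-monoʳ-≤ (p * y) (+-monoʳ-≤ (x * z) x*x≤z+x) ⟩
    p * y * (x * z + (z + x))         ≡⟨ solve (p ∷ y ∷ x ∷ z ∷ []) ⟩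
    x * z * (p * y) + p * y * (z + x) ≡⟨ cong (x * z * (p * y) +_) x*e*z≡p*y*[z+x] ⟨
    x * z * (p * y) + x * e * z       ≡⟨ solve (x ∷ z ∷ p ∷ y ∷ e ∷ []) ⟩
    x * z * (p * y + e)               ∎)
    where open ≤-Reasoning

  upper : p * y < x * e
  upper = +-cancelʳ-< _ (p * y) (x * e) (begin-strict
    p * y + x * p ≡⟨ solve (p ∷ x ∷ y ∷ []) ⟩
    p * (x + y)   <⟨ egyptian⇒p[x+y]<4xy 0<p sol ⟩
    4 * x * y     ≡⟨ solve (x ∷ y ∷ []) ⟩
    x * (4 * y)   ≡⟨ cong (x *_) e+p≡4y ⟨
    x * (e + p)   ≡⟨ *-distribˡ-+ x e p ⟩
    x * e + x * p ∎)
    where open ≤-Reasoning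

egyptian∧x*x≤z+x⇒TypeIb : ∀ {p x y z} → 0 < p → EgyptianSol p x y z → x * x ≤ z + x →
  TypeIb p x y
egyptian∧x*x≤z+x⇒TypeIb {p} {x} {y} 0<p sol x*x≤z+x =
  let lower , upper = quotient-bounds (4 * y ∸ p) 0<p sol (m∸n+n≡m (<⇒≤ p<4y)) x*x≤z+x
  in p<4y , sym (/+1-unique {{>-nonZero (m<n⇒0<n∸m p<4y)}} lower upper)
  where
  p<4y : p < 4 * y
  p<4y = *-cancelˡ-< x _ _ (begin-strict
    x * p       ≡⟨ *-comm x p ⟩
    p * x       ≤⟨ *-monoʳ-≤ p (m≤m+n x y) ⟩
    p * (x + y) <⟨ egyptian⇒p[x+y]<4xy 0<p sol ⟩
    4 * x * y   ≡⟨ solve (x ∷ y ∷ []) ⟩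
    x * (4 * y) ∎)
    where open ≤-Reasoning

record Parametrisation (p : ℕ) : Set where
  field
    x m d₁ d₂ u₁ u₂ t : ℕ
    4x≡p+m    : 4 * x ≡ p + m
    d₁u₁≡px   : d₁ * u₁ ≡ p * x
    d₂u₂≡px   : d₂ * u₂ ≡ p * x
    mt≡d₁+d₂  : m * t ≡ d₁ + d₂
    d₂≤d₁     : d₂ ≤ d₁
    d₁≤pt     : d₁ ≤ p * t
    xd₂≤pt+d₂ : x * d₂ ≤ p * t + d₂

0<*⇒0<ˡ : ∀ a n {x} → a * n ≡ x → 0 < x → 0 < a
0<*⇒0<ˡ zero    n refl ()
0<*⇒0<ˡ (suc a) n _ _ = z<s

0<*⇒0<ʳ : ∀ a n {x} → a * n ≡ x → 0 < x → 0 < n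
0<*⇒0<ʳ a n refl = 0<*⇒0<ˡ n a (*-comm n a)

split-fraction : ∀ {N m t d₁ d₂ u₁ u₂} → d₁ * u₁ ≡ N → d₂ * u₂ ≡ N → m * t ≡ d₁ + d₂ →
  m * (u₁ * t) * (u₂ * t) ≡ N * (u₁ * t + u₂ * t)
split-fraction {N} {m} {t} {d₁} {d₂} {u₁} {u₂} d₁u₁≡N d₂u₂≡N mt≡d₁+d₂ = begin
  m * (u₁ * t) * (u₂ * t)           ≡⟨ solve (m ∷ u₁ ∷ u₂ ∷ t ∷ []) ⟩
  m * t * u₁ * u₂ * t               ≡⟨ cong (λ w → w * u₁ * u₂ * t) mt≡d₁+d₂ ⟩
  (d₁ + d₂) * u₁ * u₂ * t           ≡⟨ solve (d₁ ∷ d₂ ∷ u₁ ∷ u₂ ∷ t ∷ []) ⟩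
  d₁ * u₁ * (u₂ * t) + d₂ * u₂ * (u₁ * t) ≡⟨ cong₂ (λ v w → v * (u₂ * t) + w * (u₁ * t)) d₁u₁≡N d₂u₂≡N ⟩
  N * (u₂ * t) + N * (u₁ * t)       ≡⟨ solve (N ∷ u₁ ∷ u₂ ∷ t ∷ []) ⟩
  N * (u₁ * t + u₂ * t)             ∎
  where open ≡-Reasoning

add-unit-fraction : ∀ {x p y z m} → 4 * x ≡ p + m → m * y * z ≡ p * x * (y + z) →
  4 * x * y * z ≡ p * (y * z + x * z + x * y)
add-unit-fraction {x} {p} {y} {z} {m} 4x≡p+m myz≡px[y+z] = begin
  4 * x * y * z               ≡⟨ cong (λ w → w * y * z) 4x≡p+m ⟩
  (p + m) * y * z             ≡⟨ solve (p ∷ m ∷ y ∷ z ∷ []) ⟩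
  p * y * z + m * y * z       ≡⟨ cong (p * y * z +_) myz≡px[y+z] ⟩
  p * y * z + p * x * (y + z) ≡⟨ solve (p ∷ x ∷ y ∷ z ∷ []) ⟩
  p * (y * z + x * z + x * y) ∎
  where open ≡-Reasoning

du≡px∧d≤pt⇒x≤ut : ∀ {p x t d u} → 0 < d → d * u ≡ p * x → d ≤ p * t → x ≤ u * t
du≡px∧d≤pt⇒x≤ut {p} {x} {t} {d} {u} 0<d du≡px d≤pt = *-cancelˡ-≤ d {{>-nonZero 0<d}} (begin
  d * x       ≡⟨ *-comm d x ⟩
  x * d       ≤⟨ *-monoʳ-≤ x d≤pt ⟩
  x * (p * t) ≡⟨ solve (x ∷ p ∷ t ∷ []) ⟩
  p * x * t   ≡⟨ cong (_* t) du≡px ⟨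
  d * u * t   ≡⟨ *-assoc d u t ⟩
  d * (u * t) ∎)
  where open ≤-Reasoning

du≡d′u′∧d′≤d⇒u≤u′ : ∀ {d d′ u u′} → 0 < d′ → d * u ≡ d′ * u′ → d′ ≤ d → u ≤ u′
du≡d′u′∧d′≤d⇒u≤u′ {d} {d′} {u} {u′} 0<d′ du≡d′u′ d′≤d = *-cancelˡ-≤ d′ {{>-nonZero 0<d′}} (begin
  d′ * u ≤⟨ *-monoˡ-≤ u d′≤d ⟩
  d * u  ≡⟨ du≡d′u′ ⟩
  d′ * u′ ∎)
  where open ≤-Reasoning

du≡px∧xd≤pt+d⇒x*x≤ut+x : ∀ {p x t d u} → 0 < d → d * u ≡ p * x → x * d ≤ p * t + d →
  x * x ≤ u * t + x
du≡px∧xd≤pt+d⇒x*x≤ut+x {p} {x} {t} {d} {u} 0<d du≡px xd≤pt+d = *-cancelˡ-≤ d {{>-nonZero 0<d}} (begin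
  d * (x * x)       ≡⟨ solve (d ∷ x ∷ []) ⟩
  x * (x * d)       ≤⟨ *-monoʳ-≤ x xd≤pt+d ⟩
  x * (p * t + d)   ≡⟨ solve (x ∷ p ∷ t ∷ d ∷ []) ⟩
  p * x * t + d * x ≡⟨ cong (λ w → w * t + d * x) du≡px ⟨
  d * u * t + d * x ≡⟨ solve (d ∷ u ∷ t ∷ x ∷ []) ⟩
  d * (u * t + x)   ∎)
  where open ≤-Reasoning

parametrisation⇒solution : ∀ {p} → 0 < p → Parametrisation p → HasTypeIbSolution p
parametrisation⇒solution {p} 0<p π =
  x , y , z , sol , egyptian∧x*x≤z+x⇒TypeIb 0<p sol x*x≤z+x
  where
  open Parametrisation π
  y = u₁ * t
  z = u₂ * t

  0<x  = 0<*⇒0<ʳ 4 x 4x≡p+m (≤-trans 0<p (m≤m+n p m))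
  0<px = *-pos 0<p 0<x
  0<d₁ = 0<*⇒0<ˡ d₁ u₁ d₁u₁≡px 0<px
  0<d₂ = 0<*⇒0<ˡ d₂ u₂ d₂u₂≡px 0<px
  0<t  = 0<*⇒0<ʳ m t mt≡d₁+d₂ (≤-trans 0<d₁ (m≤m+n d₁ d₂))
  0<y  = *-pos (0<*⇒0<ʳ d₁ u₁ d₁u₁≡px 0<px) 0<t
  0<z  = *-pos (0<*⇒0<ʳ d₂ u₂ d₂u₂≡px 0<px) 0<t

  x≤y = du≡px∧d≤pt⇒x≤ut {p} 0<d₁ d₁u₁≡px d₁≤pt
  y≤z = *-monoˡ-≤ t (du≡d′u′∧d′≤d⇒u≤u′ 0<d₂ (trans d₁u₁≡px (sym d₂u₂≡px)) d₂≤d₁)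
  x*x≤z+x = du≡px∧xd≤pt+d⇒x*x≤ut+x {p} 0<d₂ d₂u₂≡px xd₂≤pt+d₂

  myz≡px[y+z] : m * y * z ≡ p * x * (y + z)
  myz≡px[y+z] = split-fraction {p * x} {m} {t} {d₁} {d₂} {u₁} {u₂} d₁u₁≡px d₂u₂≡px mt≡d₁+d₂

  sol : EgyptianSol p x y z
  sol = 0<x , 0<y , 0<z , x≤y , y≤z , add-unit-fraction {x} {p} {y} {z} 4x≡p+m myz≡px[y+z]

Poly : Set
Poly = List ℕ

⟦_⟧ : Poly → ℕ → ℕ
⟦ [] ⟧     k = 0
⟦ c ∷ cs ⟧ k = c + k * ⟦ cs ⟧ k

infixl 6 _⊕_
infixl 7 _⊗_ _·_ _/ₚ_
infix 4 _≤ₚ_ _≐_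

_⊕_ : Poly → Poly → Poly
[]       ⊕ bs       = bs
(a ∷ as) ⊕ []       = a ∷ as
(a ∷ as) ⊕ (b ∷ bs) = a + b ∷ as ⊕ bs

_·_ : ℕ → Poly → Poly
c · as = map (c *_) as

_⊗_ : Poly → Poly → Poly
[]       ⊗ bs = []
(a ∷ as) ⊗ bs = a · bs ⊕ (0 ∷ as ⊗ bs)

-- Exact only if a divides every coefficient; certificates re-check whatever it produces.
_/ₚ_ : Poly → (a : ℕ) .{{_ : NonZero a}} → Poly
as /ₚ a = map (_/ a) as

_≤ₚ_ : Poly → Poly → Bool
[]       ≤ₚ bs       = true
(a ∷ as) ≤ₚ []       = (a ≤ᵇ 0) ∧ (as ≤ₚ [])
(a ∷ as) ≤ₚ (b ∷ bs) = (a ≤ᵇ b) ∧ (as ≤ₚ bs)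

_≐_ : Poly → Poly → Bool
as ≐ bs = (as ≤ₚ bs) ∧ (bs ≤ₚ as)

⟦⊕⟧ : ∀ as bs k → ⟦ as ⊕ bs ⟧ k ≡ ⟦ as ⟧ k + ⟦ bs ⟧ k
⟦⊕⟧ []       bs       k = refl
⟦⊕⟧ (a ∷ as) []       k = sym (+-identityʳ _)
⟦⊕⟧ (a ∷ as) (b ∷ bs) k rewrite ⟦⊕⟧ as bs k = rearrange a b k (⟦ as ⟧ k) (⟦ bs ⟧ k)
  where
  rearrange : ∀ a b k x y → a + b + k * (x + y) ≡ a + k * x + (b + k * y)
  rearrange = solve-∀

⟦·⟧ : ∀ c as k → ⟦ c · as ⟧ k ≡ c * ⟦ as ⟧ k
⟦·⟧ c []       k = sym (*-zeroʳ c)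
⟦·⟧ c (a ∷ as) k rewrite ⟦·⟧ c as k = rearrange c a k (⟦ as ⟧ k)
  where
  rearrange : ∀ c a k x → c * a + k * (c * x) ≡ c * (a + k * x)
  rearrange = solve-∀

⟦⊗⟧ : ∀ as bs k → ⟦ as ⊗ bs ⟧ k ≡ ⟦ as ⟧ k * ⟦ bs ⟧ k
⟦⊗⟧ []       bs k = refl
⟦⊗⟧ (a ∷ as) bs k
  rewrite ⟦⊕⟧ (a · bs) (0 ∷ as ⊗ bs) k | ⟦·⟧ a bs k | ⟦⊗⟧ as bs k = rearrange a k (⟦ as ⟧ k) (⟦ bs ⟧ k)
  where
  rearrange : ∀ a k x y → a * y + k * (x * y) ≡ (a + k * x) * y
  rearrange = solve-∀

≤ₚ-sound : ∀ as bs k → T (as ≤ₚ bs) → ⟦ as ⟧ k ≤ ⟦ bs ⟧ k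
≤ₚ-sound []       bs       k _ = z≤n
≤ₚ-sound (a ∷ as) []       k h with Equivalence.to T-∧ h
... | a≤0 , as≤[] = begin
  a + k * ⟦ as ⟧ k ≤⟨ +-mono-≤ (≤ᵇ⇒≤ a 0 a≤0) (*-monoʳ-≤ k (≤ₚ-sound as [] k as≤[])) ⟩
  0 + k * 0        ≡⟨ *-zeroʳ k ⟩
  0                ∎
  where open ≤-Reasoning
≤ₚ-sound (a ∷ as) (b ∷ bs) k h with Equivalence.to T-∧ h
... | a≤b , as≤bs = +-mono-≤ (≤ᵇ⇒≤ a b a≤b) (*-monoʳ-≤ k (≤ₚ-sound as bs k as≤bs))

≐-sound : ∀ as bs k → T (as ≐ bs) → ⟦ as ⟧ k ≡ ⟦ bs ⟧ k
≐-sound as bs k h with Equivalence.to T-∧ h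
... | as≤bs , bs≤as = ≤-antisym (≤ₚ-sound as bs k as≤bs) (≤ₚ-sound bs as k bs≤as)

⟦[_]⟧ : ∀ c k → ⟦ [ c ] ⟧ k ≡ c
⟦[ c ]⟧ k = trans (cong (c +_) (*-zeroʳ k)) (+-identityʳ c)

record Certificate : Set where
  field
    p x d₁ u₁ d₂ u₂ t : Poly
    m                 : ℕ

conditions : Certificate → List Bool
conditions c =
  (4 · x ≐ p ⊕ [ m ]) ∷ (d₁ ⊗ u₁ ≐ p ⊗ x) ∷ (d₂ ⊗ u₂ ≐ p ⊗ x) ∷ (m · t ≐ d₁ ⊕ d₂) ∷
  (d₂ ≤ₚ d₁) ∷ (d₁ ≤ₚ p ⊗ t) ∷ (x ⊗ d₂ ≤ₚ p ⊗ t ⊕ d₂) ∷ []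
  where open Certificate c

Valid : Certificate → Set
Valid c = All T (conditions c)

valid⇒parametrisation : ∀ c → Valid c → ∀ k → Parametrisation (⟦ Certificate.p c ⟧ k)
valid⇒parametrisation c (h₁ All.∷ h₂ All.∷ h₃ All.∷ h₄ All.∷ h₅ All.∷ h₆ All.∷ h₇ All.∷ All.[]) k = record
  { x         = ⟦ x ⟧ k
  ; m         = m
  ; d₁        = ⟦ d₁ ⟧ k
  ; d₂        = ⟦ d₂ ⟧ k
  ; u₁        = ⟦ u₁ ⟧ k
  ; u₂        = ⟦ u₂ ⟧ k
  ; t         = ⟦ t ⟧ k
  ; 4x≡p+m    = subst₂ _≡_ (⟦·⟧ 4 x k) (trans (⟦⊕⟧ p [ m ] k) (cong (⟦ p ⟧ k +_) (⟦[ m ]⟧ k)))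
                  (≐-sound (4 · x) (p ⊕ [ m ]) k h₁)
  ; d₁u₁≡px   = subst₂ _≡_ (⟦⊗⟧ d₁ u₁ k) (⟦⊗⟧ p x k) (≐-sound (d₁ ⊗ u₁) (p ⊗ x) k h₂)
  ; d₂u₂≡px   = subst₂ _≡_ (⟦⊗⟧ d₂ u₂ k) (⟦⊗⟧ p x k) (≐-sound (d₂ ⊗ u₂) (p ⊗ x) k h₃)
  ; mt≡d₁+d₂  = subst₂ _≡_ (⟦·⟧ m t k) (⟦⊕⟧ d₁ d₂ k) (≐-sound (m · t) (d₁ ⊕ d₂) k h₄)
  ; d₂≤d₁     = ≤ₚ-sound d₂ d₁ k h₅
  ; d₁≤pt     = subst₂ _≤_ refl (⟦⊗⟧ p t k) (≤ₚ-sound d₁ (p ⊗ t) k h₆)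
  ; xd₂≤pt+d₂ = subst₂ _≤_ (⟦⊗⟧ x d₂ k) (trans (⟦⊕⟧ (p ⊗ t) d₂ k) (cong (_+ ⟦ d₂ ⟧ k) (⟦⊗⟧ p t k)))
                  (≤ₚ-sound (x ⊗ d₂) (p ⊗ t ⊕ d₂) k h₇)
  }
  where open Certificate c

data Divisor : Set where
  _·p   : (a : ℕ) .{{_ : NonZero a}} → Divisor
  ⌜_⌝   : (a : ℕ) .{{_ : NonZero a}} → Divisor
  p·x/_ : (a : ℕ) .{{_ : NonZero a}} → Divisor
  x/_   : (a : ℕ) .{{_ : NonZero a}} → Divisor

cofactorPair : Poly → Poly → Divisor → Poly × Poly
cofactorPair p x (a ·p)   = a · p , x /ₚ a
cofactorPair p x ⌜ a ⌝    = [ a ] , p ⊗ (x /ₚ a)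
cofactorPair p x (p·x/ a) = p ⊗ (x /ₚ a) , [ a ]
cofactorPair p x (x/ a)   = x /ₚ a , a · p

record Family : Set where
  constructor family
  field
    m        : ℕ
    .{{m≢0}} : NonZero m
    δ₁ δ₂    : Divisor

residueClass : ℕ → Poly
residueClass r = r ∷ 9240 ∷ []

certificate : ℕ → Family → Certificate
certificate r f = record
  { p = p ; x = x ; d₁ = d₁ ; u₁ = u₁ ; d₂ = d₂ ; u₂ = u₂ ; t = (d₁ ⊕ d₂) /ₚ m ; m = m }
  where
  open Family f
  p = residueClass r
  x = (r + m) / 4 ∷ 2310 ∷ []   -- (p + m) / 4, as 9240 = 4 · 2310
  d₁ = proj₁ (cofactorPair p x δ₁)
  u₁ = proj₂ (cofactorPair p x δ₁)
  d₂ = proj₁ (cofactorPair p x δ₂)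
  u₂ = proj₂ (cofactorPair p x δ₂)

families : List Family
families =
  family 1 (1 ·p) (1 ·p) ∷
  family 3 (1 ·p) ⌜ 1 ⌝ ∷
  family 3 ⌜ 2 ⌝ ⌜ 1 ⌝ ∷
  family 3 (5 ·p) (x/ 1) ∷
  family 7 (1 ·p) (x/ 5) ∷
  family 7 (x/ 1) ⌜ 2 ⌝ ∷
  family 7 (x/ 2) ⌜ 2 ⌝ ∷
  family 11 (21 ·p) (1 ·p) ∷
  family 11 (p·x/ 3) (x/ 1) ∷
  family 15 (11 ·p) (x/ 1) ∷
  family 11 (1 ·p) ⌜ 1 ⌝ ∷
  family 31 (55 ·p) (x/ 10) ∷
  family 55 (x/ 2) ⌜ 2 ⌝ ∷
  family 159 (385 ·p) (x/ 35) ∷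
  family 31 (x/ 1) (x/ 154) ∷
  family 2 (1 ·p) (1 ·p) ∷ []

Certified : ℕ → Set
Certified r = Any (Valid ∘ certificate r) families

⟦residueClass⟧ : ∀ r k → ⟦ residueClass r ⟧ k ≡ r + k * 9240
⟦residueClass⟧ r k = cong (λ w → r + k * w) (⟦[ 9240 ]⟧ k)

valid⇒solution : ∀ {r} f → Valid (certificate r f) → ∀ k → 0 < r + k * 9240 →
  HasTypeIbSolution (r + k * 9240)
valid⇒solution {r} f valid k 0<p = subst HasTypeIbSolution (⟦residueClass⟧ r k)
  (parametrisation⇒solution (subst (0 <_) (sym (⟦residueClass⟧ r k)) 0<p)
    (valid⇒parametrisation (certificate r f) valid k))

certified⇒solution : ∀ {r} → Certified r → ∀ k → 0 < r + k * 9240 →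
  HasTypeIbSolution (r + k * 9240)
certified⇒solution certified = let f , valid = satisfied certified in valid⇒solution f valid

smallPrimes : List ℕ
smallPrimes = 2 ∷ 3 ∷ 5 ∷ 7 ∷ 11 ∷ []

SharesSmallPrime : ℕ → Set
SharesSmallPrime r = Any (λ q → q ∣ r × r ≢ q) smallPrimes

smallPrimes-proper∣9240 : All (λ q → 1 < q × q ∣ 9240 × q < 9240) smallPrimes
smallPrimes-proper∣9240 =
  toWitness {a? = all? (λ q → 1 <? q ×-dec q ∣? 9240 ×-dec q <? 9240) smallPrimes} _

prime⇒¬sharesSmallPrime : ∀ {p} → Prime p → ¬ SharesSmallPrime (p % 9240)
prime⇒¬sharesSmallPrime {p} p-prime shared =
  [ (λ q≡1 → <-irrefl (sym q≡1) 1<q)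
  , (λ q≡p → r≢q (trans (cong (_% 9240) (sym q≡p)) (m<n⇒m%n≡m q<9240)))
  ]′ (prime⇒irreducible p-prime (∣n∣m%n⇒∣m q∣9240 q∣r))
  where
  facts = lookupAny smallPrimes-proper∣9240 shared
  1<q    = proj₁ (proj₁ facts)
  q∣9240 = proj₁ (proj₂ (proj₁ facts))
  q<9240 = proj₂ (proj₂ (proj₁ facts))
  q∣r    = proj₁ (proj₂ facts)
  r≢q    = proj₂ (proj₂ facts)

Covered : ℕ → Set
Covered r = r ∈ excludedResidues ⊎ SharesSmallPrime r ⊎ Certified r

covered? : Decidable Covered
covered? r =
  r ∈? excludedResidues ⊎-dec
  any? (λ q → q ∣? r ×-dec ¬? (r ≟ q)) smallPrimes ⊎-dec
  any? (λ f → all? T? (conditions (certificate r f))) families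

allBelow : (ℕ → Bool) → ℕ → Bool
allBelow f zero    = true
allBelow f (suc n) = f n ∧ allBelow f n

allBelow⇒ : ∀ f n {r} → T (allBelow f n) → r < n → T (f r)
allBelow⇒ f (suc n) {r} all r<1+n with Equivalence.to T-∧ all | r ≟ n
... | fn , _    | yes refl = fn
... | _  , rest | no r≢n   = allBelow⇒ f n rest (≤∧≢⇒< (≤-pred r<1+n) r≢n)

-- Only the Boolean part of covered? is evaluated on all 9240 residues: normalising
-- allUpTo? covered? instead would also build every proof term, at several times the cost.
residues-covered : ∀ {r} → r < 9240 → Covered r
residues-covered {r} r<9240 =
  toWitness {a? = covered? r} (allBelow⇒ (isYes ∘ covered?) 9240 _ r<9240)

theorem2p6 : (p : ℕ) → Prime p → ¬ ((p % 9240) ∈ excludedResidues) →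
    HasTypeIbSolution p
theorem2p6 p p-prime p∉ =
  [ (λ excluded → contradiction excluded p∉)
  , [ (λ shared → contradiction shared (prime⇒¬sharesSmallPrime p-prime))
    , (λ certified → subst HasTypeIbSolution (sym p≡r+k*9240)
         (certified⇒solution certified (p / 9240) (subst (0 <_) p≡r+k*9240 0<p)))
    ]′
  ]′ (residues-covered (m%n<n p 9240))
  where
  p≡r+k*9240 : p ≡ p % 9240 + p / 9240 * 9240
  p≡r+k*9240 = m≡m%n+[m/n]*n p 9240

  0<p : 0 < p
  0<p = >-nonZero⁻¹ p {{prime⇒nonZero p-prime}}
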